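{- Let $G=(V,E)$ be an undirected unweighted graph with $n$ nodes, let $\beta\in[0,1]$, and let the clustering $\mathcal{C}$ and subgraph $G_{\mathcal{C}}$ be constructed by the following procedure. Start with $U:=V$, $\mathcal{C}:=\emptyset$ and $G_{\mathcal{C}}$ having node set $V$ and no edges. As long as there exists a vertex $v\in V$ with at least $\lceil n^\beta\rceil$ neighbors in $U$, choose such a $v$, let $C$ consist of exactly $\lceil n^\beta\rceil$ arbitrary neighbors of $v$ in $U$, add $C$ to $\mathcal{C}$, set $U:=U\setminus C$, and add to $G_{\mathcal{C}}$ all edges of $G$ with both endpoints in $C\cup\{v\}$. When no such vertex exists, add to $G_{\mathcal{C}}$ all edges of $G$ incident to a node of the final set $U$. Then, for any two nodes $u,v\in V$, if a shortest path $\rho$ in $G$ between $u$ and $v$ contains $t$ edges that are absent in $G_{\mathcal{C}}$, there are at least $t/2$ clusters of $\mathcal{C}$ having at least one vertex on $\rho$.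
   Context: A clustering of $G$ is a collection of pairwise disjoint subsets of $V$ (clusters), not necessarily covering $V$. Graphs are undirected and unweighted; a shortest path is one with the minimum number of edges. -}

module Defs where

open import Data.Nat using (ℕ; suc; _≤_; _*_)
open import Data.Fin using (Fin; zero; suc; inject₁; fromℕ)
open import Data.Vec using (Vec; lookup)
open import Data.List using (List; []; _∷_; length; map)
open import Data.List.Membership.Propositional using (_∈_; _∉_)
open import Data.List.Relation.Unary.All using (All)
open import Data.List.Relation.Unary.Unique.Propositional using (Unique)
open import Data.Product using (Σ; _×_; _,_; proj₁; proj₂)
open import Data.Sum using (_⊎_)
open import Relation.Nullary using (¬_; Dec)
open import Relation.Binary.PropositionalEquality using (_≡_)

record Graph (n : ℕ) : Set₁ where
  field
    Adj    : Fin n → Fin n → Set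
    sym    : ∀ {x y} → Adj x y → Adj y x
    irrefl : ∀ {x} → ¬ Adj x x
    dec    : ∀ x y → Dec (Adj x y)
open Graph public

-- One step of the procedure: a chosen vertex v together with the cluster C.
Step : ℕ → Set
Step n = Fin n × List (Fin n)

-- A history of steps, most recent step first.
History : ℕ → Set
History n = List (Step n)

module _ {n : ℕ} (G : Graph n) (k : ℕ) where

  -- x is still in U after the steps of the history, i.e. in no cluster so far.
  InU : History n → Fin n → Set
  InU hist x = ∀ {s} → s ∈ hist → x ∉ proj₂ s

  KNeighboursInU : History n → Fin n → List (Fin n) → Set
  KNeighboursInU hist v L =
    Unique L × length L ≡ k × All (λ x → Adj G v x × InU hist x) L

  HasKNeighboursInU : History n → Fin n → Set
  HasKNeighboursInU hist v = Σ (List (Fin n)) (KNeighboursInU hist v)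

  data Run : History n → Set where
    start : Run []
    step  : ∀ {hist} → Run hist → (v : Fin n) (C : List (Fin n)) →
            KNeighboursInU hist v C → Run ((v , C) ∷ hist)

  Terminated : History n → Set
  Terminated hist = ¬ Σ (Fin n) (HasKNeighboursInU hist)

  clusters : History n → List (List (Fin n))
  clusters hist = map proj₂ hist

  GCEdge : History n → Fin n → Fin n → Set
  GCEdge hist x y =
    Adj G x y ×
    ((Σ (Step n) λ s → s ∈ hist × (x ∈ (proj₁ s ∷ proj₂ s)) × (y ∈ (proj₁ s ∷ proj₂ s)))
     ⊎ (InU hist x ⊎ InU hist y))

  IsPath : Fin n → Fin n → (ℓ : ℕ) → Vec (Fin n) (suc ℓ) → Set
  IsPath u v ℓ ρ =
    lookup ρ zero ≡ u × lookup ρ (fromℕ ℓ) ≡ v ×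
    (∀ (i : Fin ℓ) → Adj G (lookup ρ (inject₁ i)) (lookup ρ (suc i)))

  IsShortestPath : Fin n → Fin n → (ℓ : ℕ) → Vec (Fin n) (suc ℓ) → Set
  IsShortestPath u v ℓ ρ =
    IsPath u v ℓ ρ × (∀ (ℓ' : ℕ) (ρ' : Vec (Fin n) (suc ℓ')) → IsPath u v ℓ' ρ' → ℓ ≤ ℓ')

  EdgeAbsent : History n → (ℓ : ℕ) → Vec (Fin n) (suc ℓ) → Fin ℓ → Set
  EdgeAbsent hist ℓ ρ i = ¬ GCEdge hist (lookup ρ (inject₁ i)) (lookup ρ (suc i))

  HasAbsentEdges : History n → (ℓ : ℕ) → Vec (Fin n) (suc ℓ) → ℕ → Set
  HasAbsentEdges hist ℓ ρ t =
    Σ (List (Fin ℓ)) λ I → Unique I × length I ≡ t × All (EdgeAbsent hist ℓ ρ) I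

  MeetsPath : (ℓ : ℕ) → Vec (Fin n) (suc ℓ) → List (Fin n) → Set
  MeetsPath ℓ ρ C = Σ (Fin (suc ℓ)) λ i → lookup ρ i ∈ C

  ManyClustersMeet : History n → (ℓ : ℕ) → Vec (Fin n) (suc ℓ) → ℕ → Set
  ManyClustersMeet hist ℓ ρ t =
    Σ (List (List (Fin n))) λ Cs →
      Unique Cs × All (λ C → C ∈ clusters hist) Cs × All (MeetsPath ℓ ρ) Cs ×
      t ≤ 2 * length Cs

-- Every edge ρᵢρᵢ₊₁ of ρ missing from G_C starts at a vertex that has left U, hence lies in some
-- cluster C with centre w. If two missing edges i < j start in the same cluster, then j ≠ i + 1,
-- because G_C keeps the edges inside C ∪ {w}, and j ≤ i + 2, because otherwise ρᵢ w ρⱼ would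
-- shortcut the shortest path ρ. Three indices cannot be pairwise two apart, so sending a missing
-- edge to the cluster of its start is at most two-to-one, and the t missing edges meet at least
-- t/2 clusters. Neither termination of the procedure nor the value of k = ⌈n^β⌉ is needed.

module Submission where

open import Defs hiding (sym)
open import Data.Nat using (ℕ; zero; suc; _+_; _*_; _∸_; _≤_; _<_; z≤n; s≤s; s≤s⁻¹; _≤?_)
open import Data.Nat.Properties
open import Data.Fin as Fin using (Fin; zero; suc; toℕ; inject₁; fromℕ; fromℕ<)
open import Data.Fin.Properties using (toℕ-inject₁; toℕ-fromℕ; toℕ-fromℕ<; toℕ<n; toℕ-injective)
open import Data.Vec using (Vec; lookup; tabulate)
open import Data.Vec.Properties using (lookup∘tabulate)
open import Data.List using (List; []; _∷_; length; map; filter; deduplicate)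
open import Data.List.Properties using (≡-dec)
open import Data.List.Membership.Propositional using (_∈_)
open import Data.List.Membership.Propositional.Properties
  using (∈-map⁺; ∈-map⁻; ∈-deduplicate⁺; ∈-deduplicate⁻)
import Data.List.Membership.DecPropositional as DecMembership
open import Data.List.Relation.Unary.All as All using (All; []; _∷_)
import Data.List.Relation.Unary.All.Properties as All
open import Data.List.Relation.Unary.Any using (here; there)
open import Data.List.Relation.Unary.AllPairs using (_∷_)
open import Data.List.Relation.Unary.Unique.Propositional using (Unique)
import Data.List.Relation.Unary.Unique.Propositional.Properties as Unique
open import Data.List.Relation.Unary.Unique.DecPropositional.Properties using (deduplicate-!)
open import Data.Bool using (true; false)
open import Data.Empty using (⊥; ⊥-elim)
open import Data.Product using (Σ-syntax; _×_; _,_; proj₁; proj₂)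
open import Data.Sum using (_⊎_; inj₁; inj₂)
open import Function using (_∘_)
open import Level using (0ℓ)
open import Relation.Nullary using (¬_; does; yes; no; contradiction)
open import Relation.Unary using (Pred; Decidable)
open import Relation.Unary.Properties using (∁?)
open import Relation.Binary.Definitions using (DecidableEquality; tri<; tri≈; tri>)
open import Relation.Binary.PropositionalEquality

TwoApart : ℕ → ℕ → Set
TwoApart x y = x ≡ 2 + y ⊎ y ≡ 2 + x

no-three-pairwise-two-apart : ∀ {x y z} → TwoApart x y → TwoApart x z → TwoApart y z → ⊥
no-three-pairwise-two-apart (inj₁ refl) (inj₁ refl) (inj₁ ())
no-three-pairwise-two-apart (inj₁ refl) (inj₁ refl) (inj₂ ())
no-three-pairwise-two-apart (inj₁ refl) (inj₂ refl) (inj₁ ())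
no-three-pairwise-two-apart (inj₁ refl) (inj₂ refl) (inj₂ ())
no-three-pairwise-two-apart (inj₂ refl) (inj₁ refl) (inj₁ ())
no-three-pairwise-two-apart (inj₂ refl) (inj₁ refl) (inj₂ ())
no-three-pairwise-two-apart (inj₂ refl) (inj₂ refl) (inj₁ ())
no-three-pairwise-two-apart (inj₂ refl) (inj₂ refl) (inj₂ ())

module _ {A : Set} {P : Pred A 0ℓ} (P? : Decidable P) where

  length-filter+filter-∁ : ∀ xs → length (filter P? xs) + length (filter (∁? P?) xs) ≡ length xs
  length-filter+filter-∁ []       = refl
  length-filter+filter-∁ (x ∷ xs) with does (P? x)
  ... | true  = cong suc (length-filter+filter-∁ xs)
  ... | false = trans (+-suc _ _) (cong suc (length-filter+filter-∁ xs))

module _ {A B : Set} (f : A → B) (P : Pred A 0ℓ) where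

  AtMostTwoToOne : Set
  AtMostTwoToOne = ∀ {a b c} → P a → P b → P c → a ≢ b → a ≢ c → b ≢ c →
                   f a ≡ f b → f b ≡ f c → ⊥

  fibre-length≤2 : AtMostTwoToOne → ∀ {y xs} → Unique xs → All (λ x → P x × f x ≡ y) xs →
                   length xs ≤ 2
  fibre-length≤2 _ _ []           = z≤n
  fibre-length≤2 _ _ (_ ∷ [])     = s≤s z≤n
  fibre-length≤2 _ _ (_ ∷ _ ∷ []) = s≤s (s≤s z≤n)
  fibre-length≤2 atMostTwo ((a≢b ∷ a≢c ∷ _) ∷ (b≢c ∷ _) ∷ _)
                           ((Pa , fa≡y) ∷ (Pb , fb≡y) ∷ (Pc , fc≡y) ∷ _) =
    ⊥-elim (atMostTwo Pa Pb Pc a≢b a≢c b≢c (trans fa≡y (sym fb≡y)) (trans fb≡y (sym fc≡y)))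

  module _ (_≟_ : DecidableEquality B) (atMostTwo : AtMostTwoToOne) where

    length≤2*length-cover : ∀ {xs} ys → Unique xs → All P xs → All (λ x → f x ∈ ys) xs →
                            length xs ≤ 2 * length ys
    length≤2*length-cover {[]}    []       _ _ _        = z≤n
    length≤2*length-cover {_ ∷ _} []       _ _ (() ∷ _)
    length≤2*length-cover {xs}    (y ∷ ys) uniq Pxs covered = begin
      length xs                                        ≡⟨ sym (length-filter+filter-∁ hits-y xs) ⟩
      length (filter hits-y xs) + length (filter misses-y xs)
        ≤⟨ +-mono-≤ (fibre-length≤2 atMostTwo (Unique.filter⁺ hits-y uniq) fibre)
                    (length≤2*length-cover ys (Unique.filter⁺ misses-y uniq)
                                           (All.filter⁺ misses-y Pxs) rest-covered) ⟩
      2 + 2 * length ys                                ≡⟨ sym (*-suc 2 (length ys)) ⟩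
      2 * length (y ∷ ys)                              ∎
      where
      open ≤-Reasoning
      hits-y : Decidable (λ x → f x ≡ y)
      hits-y x = f x ≟ y
      misses-y : Decidable (λ x → f x ≢ y)
      misses-y = ∁? hits-y
      fibre : All (λ x → P x × f x ≡ y) (filter hits-y xs)
      fibre = All.zip (All.filter⁺ hits-y Pxs , All.all-filter hits-y xs)
      rest-covered : All (λ x → f x ∈ ys) (filter misses-y xs)
      rest-covered = All.zipWith (λ { (here fx≡y , fx≢y)  → contradiction fx≡y fx≢y
                                    ; (there fx∈ys , _) → fx∈ys })
                                 (All.filter⁺ misses-y covered , All.all-filter misses-y xs)

    length≤2*length-images : ∀ {xs} → Unique xs → All P xs →
                             length xs ≤ 2 * length (deduplicate _≟_ (map f xs))
    length≤2*length-images uniq Pxs =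
      length≤2*length-cover _ uniq Pxs (All.tabulate (∈-deduplicate⁺ _≟_ ∘ ∈-map⁺ f))

-- Walks are sequences indexed by all of ℕ, of which only an initial segment matters, so that they
-- can be spliced by index arithmetic.
_⟨_⟩++_ : {A : Set} → (ℕ → A) → ℕ → (ℕ → A) → ℕ → A
(X ⟨ p ⟩++ Y) m with m ≤? p
... | yes _ = X m
... | no _  = Y (m ∸ p)

module _ {A : Set} (X Y : ℕ → A) {p : ℕ} where

  ++-≤ : ∀ {m} → m ≤ p → (X ⟨ p ⟩++ Y) m ≡ X m
  ++-≤ {m} m≤p with m ≤? p
  ... | yes _   = refl
  ... | no m≰p = contradiction m≤p m≰p

  ++-≥ : X p ≡ Y 0 → ∀ {m} → p ≤ m → (X ⟨ p ⟩++ Y) m ≡ Y (m ∸ p)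
  ++-≥ Xp≡Y0 {m} p≤m with m ≤? p
  ... | yes m≤p rewrite ≤-antisym m≤p p≤m | n∸n≡0 p = Xp≡Y0
  ... | no _    = refl

detour : {A : Set} → A → A → A → ℕ → A
detour x w y zero          = x
detour x w y (suc zero)    = w
detour x w y (suc (suc _)) = y

-- X₀ … Xₐ w X_b X_{b+1} …
shortcut : {A : Set} → (ℕ → A) → ℕ → A → ℕ → ℕ → A
shortcut X a w b = X ⟨ a ⟩++ (detour (X a) w (X b) ⟨ 2 ⟩++ (X ∘ (b +_)))

-- clamp ℓ m is min m ℓ, read as a position in a vector of length suc ℓ.
clamp : (ℓ : ℕ) → ℕ → Fin (suc ℓ)
clamp ℓ       zero    = zero
clamp zero    (suc m) = zero
clamp (suc ℓ) (suc m) = suc (clamp ℓ m)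

clamp-toℕ : ∀ {ℓ} (i : Fin (suc ℓ)) → clamp ℓ (toℕ i) ≡ i
clamp-toℕ zero = refl
clamp-toℕ {suc ℓ} (suc i) = cong suc (clamp-toℕ i)

lookup-clamp : ∀ {A : Set} {ℓ m} (ρ : Vec A (suc ℓ)) (i : Fin (suc ℓ)) → toℕ i ≡ m →
               lookup ρ (clamp ℓ m) ≡ lookup ρ i
lookup-clamp ρ i refl = cong (lookup ρ) (clamp-toℕ i)

module _ {n : ℕ} (G : Graph n) where

  IsWalk : (ℕ → Fin n) → ℕ → Set
  IsWalk X ℓ = ∀ m → m < ℓ → Adj G (X m) (X (suc m))

  IsWalk-prefix : ∀ {X ℓ ℓ'} → ℓ' ≤ ℓ → IsWalk X ℓ → IsWalk X ℓ'
  IsWalk-prefix ℓ'≤ℓ walk m m<ℓ' = walk m (<-≤-trans m<ℓ' ℓ'≤ℓ)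

  IsWalk-++ : ∀ {X Y p q} → IsWalk X p → IsWalk Y q → X p ≡ Y 0 → IsWalk (X ⟨ p ⟩++ Y) (p + q)
  IsWalk-++ {X} {Y} {p} {q} walkX walkY Xp≡Y0 m m<p+q with <-≤-connex m p
  ... | inj₁ m<p = subst₂ (Adj G) (sym (++-≤ X Y (<⇒≤ m<p))) (sym (++-≤ X Y m<p)) (walkX m m<p)
  ... | inj₂ p≤m = subst₂ (Adj G) (sym (++-≥ X Y Xp≡Y0 p≤m))
                     (sym (trans (++-≥ X Y Xp≡Y0 (m≤n⇒m≤1+n p≤m)) (cong Y (+-∸-assoc 1 p≤m))))
                     (walkY (m ∸ p) (subst (m ∸ p <_) (m+n∸m≡n p q) (∸-monoˡ-< m<p+q p≤m)))

  IsWalk-drop : ∀ {X ℓ b} → b ≤ ℓ → IsWalk X ℓ → IsWalk (X ∘ (b +_)) (ℓ ∸ b)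
  IsWalk-drop {X} {ℓ} {b} b≤ℓ walk m m<ℓ∸b =
    subst (Adj G (X (b + m)) ∘ X) (sym (+-suc b m)) (walk (b + m) b+m<ℓ)
    where
    b+m<ℓ : b + m < ℓ
    b+m<ℓ = subst (_≤ ℓ) (trans (+-comm (suc m) b) (+-suc b m)) (m≤o∸n⇒m+n≤o (suc m) b≤ℓ m<ℓ∸b)

  IsWalk-detour : ∀ {x w y} → Adj G x w → Adj G w y → IsWalk (detour x w y) 2
  IsWalk-detour xw wy zero          _ = xw
  IsWalk-detour xw wy (suc zero)    _ = wy
  IsWalk-detour xw wy (suc (suc _)) (s≤s (s≤s ()))

  module _ (X : ℕ → Fin n) (a : ℕ) (w : Fin n) (b : ℕ) where

    private
      b+0≡b : X (b + 0) ≡ X b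
      b+0≡b = cong X (+-identityʳ b)

      tail : ℕ → Fin n
      tail = detour (X a) w (X b) ⟨ 2 ⟩++ (X ∘ (b +_))

    IsWalk-shortcut : ∀ {ℓ} → a ≤ ℓ → b ≤ ℓ → IsWalk X ℓ → Adj G w (X a) → Adj G w (X b) →
                      IsWalk (shortcut X a w b) (a + (2 + (ℓ ∸ b)))
    IsWalk-shortcut a≤ℓ b≤ℓ walk wXa wXb =
      IsWalk-++ (IsWalk-prefix a≤ℓ walk)
        (IsWalk-++ (IsWalk-detour (Graph.sym G wXa) wXb) (IsWalk-drop b≤ℓ walk) (sym b+0≡b))
        refl

    shortcut-start : shortcut X a w b 0 ≡ X 0
    shortcut-start = ++-≤ X tail {a} z≤n

    shortcut-end : ∀ {ℓ} → b ≤ ℓ → shortcut X a w b (a + (2 + (ℓ ∸ b))) ≡ X ℓ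
    shortcut-end {ℓ} b≤ℓ = begin
      shortcut X a w b (a + (2 + (ℓ ∸ b)))  ≡⟨ ++-≥ X tail refl (m≤m+n a _) ⟩
      tail (a + (2 + (ℓ ∸ b)) ∸ a)          ≡⟨ cong tail (m+n∸m≡n a _) ⟩
      tail (2 + (ℓ ∸ b))                    ≡⟨ ++-≥ (detour (X a) w (X b)) (X ∘ (b +_)) (sym b+0≡b)
                                                     (m≤m+n 2 _) ⟩
      X (b + (2 + (ℓ ∸ b) ∸ 2))             ≡⟨ cong (λ m → X (b + m)) (m+n∸m≡n 2 (ℓ ∸ b)) ⟩
      X (b + (ℓ ∸ b))                       ≡⟨ cong X (m+[n∸m]≡n b≤ℓ) ⟩
      X ℓ                                   ∎
      where open ≡-Reasoning

module _ {n : ℕ} (G : Graph n) (k : ℕ) where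

  IsWalk⇒IsPath : ∀ {X ℓ} → IsWalk G X ℓ → IsPath G k (X 0) (X ℓ) ℓ (tabulate (X ∘ toℕ))
  IsWalk⇒IsPath {X} {ℓ} walk = lookup∘tabulate (X ∘ toℕ) (zero {ℓ}) , end , edges
    where
    end : lookup (tabulate (X ∘ toℕ)) (fromℕ ℓ) ≡ X ℓ
    end = trans (lookup∘tabulate (X ∘ toℕ) (fromℕ ℓ)) (cong X (toℕ-fromℕ ℓ))
    edges : ∀ i → Adj G (lookup (tabulate (X ∘ toℕ)) (inject₁ i)) (lookup (tabulate (X ∘ toℕ)) (suc i))
    edges i = subst₂ (Adj G)
                (sym (trans (lookup∘tabulate (X ∘ toℕ) (inject₁ i)) (cong X (toℕ-inject₁ i))))
                (sym (lookup∘tabulate (X ∘ toℕ) (suc i)))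
                (walk (toℕ i) (toℕ<n i))

  module _ {u v : Fin n} {ℓ : ℕ} (ρ : Vec (Fin n) (suc ℓ)) (path : IsPath G k u v ℓ ρ) where
    IsPath⇒IsWalk : IsWalk G (lookup ρ ∘ clamp ℓ) ℓ
    IsPath⇒IsWalk m m<ℓ =
      subst₂ (Adj G) (sym (lookup-clamp ρ (inject₁ i) (trans (toℕ-inject₁ i) (toℕ-fromℕ< m<ℓ))))
                     (sym (lookup-clamp ρ (suc i) (cong suc (toℕ-fromℕ< m<ℓ))))
                     (proj₂ (proj₂ path) i)
      where i = fromℕ< m<ℓ

    IsPath-end : lookup ρ (clamp ℓ ℓ) ≡ v
    IsPath-end = trans (lookup-clamp ρ (fromℕ ℓ) (toℕ-fromℕ ℓ)) (proj₁ (proj₂ path))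

  shortest-path-common-neighbour :
    ∀ {u v w ℓ} (ρ : Vec (Fin n) (suc ℓ)) → IsShortestPath G k u v ℓ ρ → (i j : Fin (suc ℓ)) →
    Adj G w (lookup ρ i) → Adj G w (lookup ρ j) → toℕ j ≤ 2 + toℕ i
  shortest-path-common-neighbour {u} {v} {w} {ℓ} ρ (path , minimal) i j wρi wρj
    with toℕ j ≤? 2 + toℕ i
  ... | yes j≤2+i = j≤2+i
  ... | no j≰2+i  = contradiction (minimal ℓ' ρ' path') (<⇒≱ ℓ'<ℓ)
    where
    a b ℓ' : ℕ
    a  = toℕ i
    b  = toℕ j
    ℓ' = a + (2 + (ℓ ∸ b))

    a≤ℓ : a ≤ ℓ
    a≤ℓ = s≤s⁻¹ (toℕ<n i)

    b≤ℓ : b ≤ ℓ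
    b≤ℓ = s≤s⁻¹ (toℕ<n j)

    X : ℕ → Fin n
    X = lookup ρ ∘ clamp ℓ

    walk : IsWalk G (shortcut X a w b) ℓ'
    walk = IsWalk-shortcut G X a w b a≤ℓ b≤ℓ (IsPath⇒IsWalk ρ path)
             (subst (Adj G w) (sym (lookup-clamp ρ i refl)) wρi)
             (subst (Adj G w) (sym (lookup-clamp ρ j refl)) wρj)

    ρ' : Vec (Fin n) (suc ℓ')
    ρ' = tabulate (shortcut X a w b ∘ toℕ)

    path' : IsPath G k u v ℓ' ρ'
    path' = subst₂ (λ x y → IsPath G k x y ℓ' ρ')
              (trans (shortcut-start G X a w b) (proj₁ path))
              (trans (shortcut-end G X a w b b≤ℓ) (IsPath-end ρ path))
              (IsWalk⇒IsPath walk)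

    ℓ'<ℓ : ℓ' < ℓ
    ℓ'<ℓ = begin-strict
      a + (2 + (ℓ ∸ b)) ≡⟨ sym (+-assoc a 2 _) ⟩
      a + 2 + (ℓ ∸ b)   ≡⟨ cong (_+ (ℓ ∸ b)) (+-comm a 2) ⟩
      2 + a + (ℓ ∸ b)   <⟨ +-monoˡ-< (ℓ ∸ b) (≰⇒> j≰2+i) ⟩
      b + (ℓ ∸ b)       ≡⟨ m+[n∸m]≡n b≤ℓ ⟩
      ℓ                 ∎
      where open ≤-Reasoning

module _ {n : ℕ} where

  open DecMembership (Fin._≟_ {n}) using (_∈?_)

  clusterOf : History n → Fin n → List (Fin n)
  clusterOf []               x = []
  clusterOf ((_ , C) ∷ hist) x with x ∈? C
  ... | yes _ = C
  ... | no _  = clusterOf hist x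

  edgeCluster : History n → ∀ {ℓ} → Vec (Fin n) (suc ℓ) → Fin ℓ → List (Fin n)
  edgeCluster hist ρ i = clusterOf hist (lookup ρ (inject₁ i))

  clusterOf-sound : ∀ (G : Graph n) k hist {x} → ¬ InU G k hist x →
                    Σ[ w ∈ Fin n ] (w , clusterOf hist x) ∈ hist × x ∈ clusterOf hist x
  clusterOf-sound G k []               x∉U = contradiction (λ ()) x∉U
  clusterOf-sound G k ((w , C) ∷ hist) {x} x∉U with x ∈? C
  ... | yes x∈C = w , here refl , x∈C
  ... | no x∉C  =
    let w′ , step∈ , x∈ = clusterOf-sound G k hist λ x∈U →
                            x∉U λ { (here refl) → x∉C ; (there s∈) → x∈U s∈ }
    in  w′ , there step∈ , x∈

module _ {n : ℕ} (G : Graph n) (k : ℕ) where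

  Run⇒centre-adjacent : ∀ {hist} → Run G k hist →
                        ∀ {w C x} → (w , C) ∈ hist → x ∈ C → Adj G w x
  Run⇒centre-adjacent (step _ _ _ (_ , _ , C-adj)) (here refl) x∈C = proj₁ (All.lookup C-adj x∈C)
  Run⇒centre-adjacent (step run _ _ _)              (there s∈)  x∈C = Run⇒centre-adjacent run s∈ x∈C

  module _ {hist : History n} (run : Run G k hist) {u v : Fin n} {ℓ : ℕ}
           (ρ : Vec (Fin n) (suc ℓ)) (shortest : IsShortestPath G k u v ℓ ρ) where

    private
      ρ-edge : ∀ i → Adj G (lookup ρ (inject₁ i)) (lookup ρ (suc i))
      ρ-edge = proj₂ (proj₂ (proj₁ shortest))

    EdgeAbsent⇒edgeCluster : ∀ {i} → EdgeAbsent G k hist ℓ ρ i →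
                             Σ[ w ∈ Fin n ] (w , edgeCluster hist ρ i) ∈ hist ×
                                            lookup ρ (inject₁ i) ∈ edgeCluster hist ρ i
    EdgeAbsent⇒edgeCluster {i} absent =
      clusterOf-sound G k hist λ ρi∈U → absent (ρ-edge i , inj₂ (inj₁ ρi∈U))

    absent-edges-in-cluster : ∀ {i j w C} → toℕ i < toℕ j → EdgeAbsent G k hist ℓ ρ i →
                              (w , C) ∈ hist → lookup ρ (inject₁ i) ∈ C → lookup ρ (inject₁ j) ∈ C →
                              toℕ j ≡ 2 + toℕ i
    absent-edges-in-cluster {i} {j} {w} {C} i<j absent step∈ ρi∈C ρj∈C =
      ≤-antisym j≤2+i (≤∧≢⇒< i<j j≢1+i)
      where
      j≤2+i : toℕ j ≤ 2 + toℕ i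
      j≤2+i = subst₂ (λ a b → b ≤ 2 + a) (toℕ-inject₁ i) (toℕ-inject₁ j)
                (shortest-path-common-neighbour G k ρ shortest (inject₁ i) (inject₁ j)
                  (Run⇒centre-adjacent run step∈ ρi∈C) (Run⇒centre-adjacent run step∈ ρj∈C))

      j≢1+i : suc (toℕ i) ≢ toℕ j
      j≢1+i j≡1+i = absent (ρ-edge i , inj₁ ((w , C) , step∈ , there ρi∈C , there ρi+1∈C))
        where
        ρi+1∈C : lookup ρ (suc i) ∈ C
        ρi+1∈C = subst (λ j → lookup ρ j ∈ C)
                   (toℕ-injective (trans (toℕ-inject₁ j) (sym j≡1+i))) ρj∈C

    absent-edges-two-apart : ∀ {i j} → i ≢ j →
                             EdgeAbsent G k hist ℓ ρ i → EdgeAbsent G k hist ℓ ρ j →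
                             edgeCluster hist ρ i ≡ edgeCluster hist ρ j → TwoApart (toℕ i) (toℕ j)
    absent-edges-two-apart {i} {j} i≢j absent-i absent-j same
      with EdgeAbsent⇒edgeCluster absent-i | EdgeAbsent⇒edgeCluster absent-j | <-cmp (toℕ i) (toℕ j)
    ... | _ , step-i , ρi∈ | _ , _ , ρj∈ | tri< i<j _ _ =
      inj₂ (absent-edges-in-cluster i<j absent-i step-i ρi∈ (subst (_ ∈_) (sym same) ρj∈))
    ... | _ | _ | tri≈ _ i≡j _ = contradiction (toℕ-injective i≡j) i≢j
    ... | _ , _ , ρi∈ | _ , step-j , ρj∈ | tri> _ _ j<i =
      inj₁ (absent-edges-in-cluster j<i absent-j step-j ρj∈ (subst (_ ∈_) same ρi∈))

    edgeCluster-at-most-two-to-one : AtMostTwoToOne (edgeCluster hist ρ) (EdgeAbsent G k hist ℓ ρ)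
    edgeCluster-at-most-two-to-one absent-a absent-b absent-c a≢b a≢c b≢c same-ab same-bc =
      no-three-pairwise-two-apart (absent-edges-two-apart a≢b absent-a absent-b same-ab)
                                  (absent-edges-two-apart a≢c absent-a absent-c (trans same-ab same-bc))
                                  (absent-edges-two-apart b≢c absent-b absent-c same-bc)

    edgeCluster-meets : ∀ {i} → EdgeAbsent G k hist ℓ ρ i →
                        edgeCluster hist ρ i ∈ clusters G k hist ×
                        MeetsPath G k ℓ ρ (edgeCluster hist ρ i)
    edgeCluster-meets {i} absent with EdgeAbsent⇒edgeCluster absent
    ... | _ , step∈ , ρi∈ = ∈-map⁺ proj₂ step∈ , inject₁ i , ρi∈

lemma2 : ∀ (n : ℕ) (G : Graph n) (k : ℕ) → 1 ≤ k → k ≤ n →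
         (hist : History n) → Run G k hist → Terminated G k hist →
         ∀ (u v : Fin n) (ℓ : ℕ) (ρ : Vec (Fin n) (suc ℓ)) →
         IsShortestPath G k u v ℓ ρ →
         ∀ (t : ℕ) → HasAbsentEdges G k hist ℓ ρ t →
         ManyClustersMeet G k hist ℓ ρ t
lemma2 n G k _ _ hist run _ _ _ ℓ ρ shortest _ (I , I-unique , refl , I-absent) =
  Cs , deduplicate-! _≟ᶜ_ _ , All.tabulate (proj₁ ∘ meets) , All.tabulate (proj₂ ∘ meets) ,
  length≤2*length-images (edgeCluster hist ρ) (EdgeAbsent G k hist ℓ ρ) _≟ᶜ_
    (edgeCluster-at-most-two-to-one G k run ρ shortest) I-unique I-absent
  where
  _≟ᶜ_ : DecidableEquality (List (Fin n))
  _≟ᶜ_ = ≡-dec Fin._≟_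
  Cs : List (List (Fin n))
  Cs = deduplicate _≟ᶜ_ (map (edgeCluster hist ρ) I)
  meets : ∀ {C} → C ∈ Cs → C ∈ clusters G k hist × MeetsPath G k ℓ ρ C
  meets C∈Cs with ∈-map⁻ (edgeCluster hist ρ) (∈-deduplicate⁻ _≟ᶜ_ _ C∈Cs)
  ... | i , i∈I , refl = edgeCluster-meets G k run ρ shortest (All.lookup I-absent i∈I)
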